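{- Let $\mathcal{U}$ be a universe, in a topos with natural numbers object, that satisfies the axiom IWISC. Then for every indexed signature $\Sigma=(I,A,B)$ in $\mathcal{U}$ and every system of equations $\varepsilon=(E,V,l,r)$ over $\Sigma$ in $\mathcal{U}$, there exists a QWI-type for $(\Sigma,\varepsilon)$.
   Context: We work in extensional Martin-Löf type theory used as the internal language of a topos with natural numbers object and a hierarchy of universes $\mathcal{U}$ (closed under $\Pi$, $\Sigma$, coproducts, finite types and inductively defined indexed families); the lowest universe contains the impredicative universe $\mathrm{Prop}$ of propositions (the subobject classifier), and we have propositional extensionality, function extensionality, unique choice and quotient types. A family in $\mathcal{U}$ is a pair $(A,B)$ with $A:\mathcal{U}$ and $B:A\to\mathcal{U}$. A family $(C,F)$ in $\mathcal{U}$ is a wisc for $Y:\mathcal{U}$ if for every $X:\mathcal{U}$ and every surjection $q:X\to Y$ there exist $c:C$ and $f:F\,c\to X$ with $q\circ f$ surjective; it is a wisc for a family $(A,B)$ if it is a wisc for each $B\,a$. The universe $\mathcal{U}$ satisfies IWISC if for every family $(A,B)$ in $\mathcal{U}$ there exists a family in $\mathcal{U}$ which is a wisc for $(A,B)$. For $I:\mathcal{U}$ and $X,Y:\mathcal{U}^I$ write $X\rightharpoonup Y:=\prod_{k:I}X_k\to Y_k$. An indexed signature is a triple $\Sigma=(I,A,B)$ with $I:\mathcal{U}$, $A:\mathcal{U}^I$ and $B:\prod_{i:I}(A_i\to\mathcal{U}^I)$. Its polynomial endofunctor $S_\Sigma:\mathcal{U}^I\to\mathcal{U}^I$ is $(S_\Sigma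 X)_i:=\sum_{a:A_i}(B_i\,a\rightharpoonup X)$, acting on $h:X\rightharpoonup Y$ by $(a,b)\mapsto(a,h\circ b)$. An $S_\Sigma$-algebra is $X:\mathcal{U}^I$ with $\alpha:S_\Sigma X\rightharpoonup X$; a morphism $(X,\alpha)\to(X',\alpha')$ is $h:X\rightharpoonup X'$ with $\alpha'_i(a,h\circ b)=h_i(\alpha_i(a,b))$ for all $i,a,b$. For $V:\mathcal{U}^I$, $T_\Sigma V:\mathcal{U}^I$ is the inductive family with constructors $\eta:V\rightharpoonup T_\Sigma V$ and $\sigma:S_\Sigma(T_\Sigma V)\rightharpoonup T_\Sigma V$. Given an algebra $(X,\alpha)$ and $f:V\rightharpoonup X$, $t\ggg f$ (for $t:(T_\Sigma V)_i$) is defined by $\eta\,x\ggg f:=f\,x$ and $\sigma(a,b)\ggg f:=\alpha(a,\lambda x.\,b\,x\ggg f)$. A system of equations over $\Sigma$ is $\varepsilon=(E,V,l,r)$ with $E:\mathcal{U}^I$, $V:\prod_{i:I}(E_i\to\mathcal{U}^I)$ and $l,r:\prod_{i:I}\prod_{e:E_i}(T_\Sigma(V_i\,e))_i$. An algebra $(X,\alpha)$ satisfies $\varepsilon$ if for all $i:I$, $e:E_i$ and $\rho:V_i\,e\rightharpoonup X$ we have $(l_i\,e\ggg\rho)=(r_i\,e\ggg\rho)$. A QWI-type for $(\Sigma,\varepsilon)$ is a family $QW:\mathcal{U}^I$ with an $S_\Sigma$-algebra structure $\mathrm{qwintro}:S_\Sigma(QW)\rightharpoonup QW$ satisfying $\varepsilon$,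 such that for every $S_\Sigma$-algebra $(X,\alpha)$ satisfying $\varepsilon$ there is a unique $S_\Sigma$-algebra morphism $(QW,\mathrm{qwintro})\to(X,\alpha)$ (i.e. it is an initial algebra among those satisfying $\varepsilon$). -}

module Defs where

open import Level using (Level; _⊔_; Setω) renaming (suc to lsuc; zero to lzero)
open import Data.Product using (Σ; Σ-syntax; _,_; proj₁; proj₂; _×_)
open import Function using (_∘_; _⇔_)
open import Relation.Binary.PropositionalEquality using (_≡_; subst)
open import Axiom.Extensionality.Propositional using (Extensionality)

-- Ambient axioms of the internal language of the topos
-- (extensional MLTT: UIP holds via Agda's K, which is on by default;
--  natural numbers object: Agda's ℕ; the remaining structure is
--  assumed explicitly as hypotheses below.)

isProp : ∀ {a} → Set a → Set a
isProp P = (x y : P) → x ≡ y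

record Axioms : Setω where
  field
    funext : ∀ {a b} → Extensionality a b
    propext : ∀ {a} {P Q : Set a} → isProp P → isProp Q → (P ⇔ Q) → P ≡ Q
    -- propositional truncation (the "there exists" of the topos logic)
    ∥_∥ : ∀ {a} → Set a → Set a
    ∣_∣ : ∀ {a} {A : Set a} → A → ∥ A ∥
    ∥∥-isProp : ∀ {a} {A : Set a} → isProp ∥ A ∥
    ∥∥-rec : ∀ {a b} {A : Set a} {B : Set b} → isProp B → (A → B) → ∥ A ∥ → B
    _/_ : ∀ {a r} (A : Set a) (R : A → A → Set r) → Set (a ⊔ r)
    [_] : ∀ {a r} {A : Set a} {R : A → A → Set r} → A → A / R
    /-eq : ∀ {a r} {A : Set a} {R : A → A → Set r} {x y : A} → R x y → [_] {R = R} x ≡ [ y ]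
    /-elim : ∀ {a r b} {A : Set a} {R : A → A → Set r} (P : A / R → Set b)
             (f : (x : A) → P [ x ])
             → (∀ {x y} (p : R x y) → subst P (/-eq p) (f x) ≡ f y)
             → (q : A / R) → P q
    /-elim-β : ∀ {a r b} {A : Set a} {R : A → A → Set r} (P : A / R → Set b)
               (f : (x : A) → P [ x ])
               (p : ∀ {x y} (p : R x y) → subst P (/-eq p) (f x) ≡ f y)
               (x : A) → /-elim P f p [ x ] ≡ f x
    -- impredicative universe of propositions Prop in the lowest universe
    -- (subobject classifier): every proposition of any universe is
    -- classified by an element of Ω.
    Ω : Set
    El : Ω → Set
    El-isProp : (ω : Ω) → isProp (El ω)
    ⌜_⌝ : ∀ {a} (P : Set a) → isProp P → Ω
    ⌜⌝-spec : ∀ {a} (P : Set a) (p : isProp P) → El (⌜ P ⌝ p) ⇔ P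
    Ω-ext : (ω ω′ : Ω) → (El ω ⇔ El ω′) → ω ≡ ω′

module _ (ax : Axioms) where
  open Axioms ax

  IsSurjective : ∀ {a b} {X : Set a} {Y : Set b} → (X → Y) → Set (a ⊔ b)
  IsSurjective {X = X} {Y} q = (y : Y) → ∥ Σ[ x ∈ X ] q x ≡ y ∥

  IsWiscFor : ∀ {ℓ} (C : Set ℓ) (F : C → Set ℓ) (Y : Set ℓ) → Set (lsuc ℓ)
  IsWiscFor {ℓ} C F Y =
    (X : Set ℓ) (q : X → Y) → IsSurjective q →
    ∥ Σ[ c ∈ C ] Σ[ f ∈ (F c → X) ] IsSurjective (q ∘ f) ∥

  IsWiscForFamily : ∀ {ℓ} (C : Set ℓ) (F : C → Set ℓ) (A : Set ℓ) (B : A → Set ℓ)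
                    → Set (lsuc ℓ)
  IsWiscForFamily C F A B = (a : A) → IsWiscFor C F (B a)

  IWISC : (ℓ : Level) → Set (lsuc ℓ)
  IWISC ℓ = (A : Set ℓ) (B : A → Set ℓ) →
    ∥ Σ[ C ∈ Set ℓ ] Σ[ F ∈ (C → Set ℓ) ] IsWiscForFamily C F A B ∥

_⇀_ : ∀ {ℓ} {I : Set ℓ} → (I → Set ℓ) → (I → Set ℓ) → Set ℓ
_⇀_ {I = I} X Y = (k : I) → X k → Y k

record Sig (ℓ : Level) : Set (lsuc ℓ) where
  field
    I : Set ℓ
    A : I → Set ℓ
    B : (i : I) → A i → (I → Set ℓ)

module _ {ℓ : Level} (Σ' : Sig ℓ) where
  open Sig Σ'

  S : (I → Set ℓ) → (I → Set ℓ)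
  S X i = Σ[ a ∈ A i ] (B i a ⇀ X)

  S-map : {X Y : I → Set ℓ} → X ⇀ Y → S X ⇀ S Y
  S-map h i (a , b) = a , (λ k x → h k (b k x))

  record Alg : Set (lsuc ℓ) where
    field
      Carrier : I → Set ℓ
      α : S Carrier ⇀ Carrier

  IsAlgMorphism : (X X′ : Alg) → Alg.Carrier X ⇀ Alg.Carrier X′ → Set ℓ
  IsAlgMorphism X X′ h =
    (i : I) (a : A i) (b : B i a ⇀ Alg.Carrier X) →
    Alg.α X′ i (a , (λ k x → h k (b k x))) ≡ h i (Alg.α X i (a , b))

  data T (V : I → Set ℓ) : I → Set ℓ where
    η : {i : I} → V i → T V i
    σ : {i : I} → S (T V) i → T V i

  _⋙_ : {V : I → Set ℓ} (X : Alg) {i : I} → T V i → V ⇀ Alg.Carrier X → Alg.Carrier X i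
  _⋙_ X (η x) f = f _ x
  _⋙_ X {i} (σ (a , b)) f = Alg.α X i (a , (λ k x → _⋙_ X (b k x) f))

  record Eqs : Set (lsuc ℓ) where
    field
      E : I → Set ℓ
      V : (i : I) → E i → (I → Set ℓ)
      l r : (i : I) (e : E i) → T (V i e) i

  Satisfies : Alg → Eqs → Set ℓ
  Satisfies X ε =
    (i : I) (e : Eqs.E ε i) (ρ : Eqs.V ε i e ⇀ Alg.Carrier X) →
    _⋙_ X (Eqs.l ε i e) ρ ≡ _⋙_ X (Eqs.r ε i e) ρ

  record QWI (ε : Eqs) : Set (lsuc ℓ) where
    field
      QW : I → Set ℓ
      qwintro : S QW ⇀ QW
      qwsat : Satisfies (record { Carrier = QW ; α = qwintro }) ε
      qwinit : (X : Alg) → Satisfies X ε →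
        Σ[ h ∈ (QW ⇀ Alg.Carrier X) ]
          (IsAlgMorphism (record { Carrier = QW ; α = qwintro }) X h ×
           ((h′ : QW ⇀ Alg.Carrier X) →
              IsAlgMorphism (record { Carrier = QW ; α = qwintro }) X h′ → h′ ≡ h))

-- Use a wisc for the positions Σ[ k ∈ I ] B i a k to bound the branching of well-founded
-- "wisc trees", whose nodes carry an operation a and a surjection from some F c onto its
-- positions. Say a tree denotes x in an algebra if x is obtained by evaluating it, whatever
-- the choice of argument along each surjection; denotations are unique. Keep the trees that
-- have a denotation in every algebra satisfying ε (a small type, by impredicativity of Ω),
-- and identify two of them when their denotations agree in all such algebras. Every operation
-- applied to arguments from this quotient is represented by a tree, because the wisc covers
-- the surjection from tree representatives onto argument positions; uniqueness of morphisms
-- holds because morphisms preserve denotations and every tree denotes its own class.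
module Submission where

open import Level using (Level; _⊔_) renaming (suc to lsuc)
open import Data.Product using (Σ; Σ-syntax; _,_; proj₁; proj₂; _×_)
open import Function using (_∘_; Equivalence)
open import Relation.Binary.PropositionalEquality
  using (_≡_; refl; sym; trans; cong; subst; module ≡-Reasoning)
open import Axiom.UniquenessOfIdentityProofs.WithK using (uip)
open import Defs

subst-const : ∀ {a b} {X : Set a} {Y : Set b} {x x′ : X} (e : x ≡ x′) (y : Y) → subst (λ _ → Y) e y ≡ y
subst-const refl y = refl

module Ambient (ax : Axioms) where
  open Axioms ax

  Π-isProp : ∀ {a b} {X : Set a} {P : X → Set b} →
             ((x : X) → isProp (P x)) → isProp ((x : X) → P x)
  Π-isProp P-isProp f g = funext λ x → P-isProp x (f x) (g x)

  Σ-≡-isProp : ∀ {a b} {X : Set a} {P : X → Set b} → ((x : X) → isProp (P x)) →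
               {u v : Σ X P} → proj₁ u ≡ proj₁ v → u ≡ v
  Σ-≡-isProp P-isProp {x , p} {.x , q} refl = cong (x ,_) (P-isProp x p q)

  ∥∥-map : ∀ {a b} {X : Set a} {Y : Set b} → (X → Y) → ∥ X ∥ → ∥ Y ∥
  ∥∥-map f = ∥∥-rec ∥∥-isProp (∣_∣ ∘ f)

  AtMostOne : ∀ {a b} {X : Set a} → (X → Set b) → Set (a ⊔ b)
  AtMostOne P = ∀ {x y} → P x → P y → x ≡ y

  ∥∥-atMostOne : ∀ {a b} {X : Set a} {P : X → Set b} → AtMostOne P → AtMostOne (∥_∥ ∘ P)
  ∥∥-atMostOne unique p q = ∥∥-rec uip (λ p′ → ∥∥-rec uip (unique p′) q) p

  unique-choice : ∀ {a b} {X : Set a} {P : X → Set b} →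
                  AtMostOne P → ∥ Σ X P ∥ → Σ[ x ∈ X ] ∥ P x ∥
  unique-choice {P = P} unique = ∥∥-rec isProp-Σ (λ (x , p) → x , ∣ p ∣)
    where
    isProp-Σ : isProp (Σ[ x ∈ _ ] ∥ P x ∥)
    isProp-Σ (x , p) (y , q) = Σ-≡-isProp (λ _ → ∥∥-isProp) (∥∥-atMostOne unique p q)

  Small : ∀ {a} (P : Set a) → isProp P → Set
  Small P P-isProp = El (⌜ P ⌝ P-isProp)

  to-small : ∀ {a} {P : Set a} {P-isProp : isProp P} → P → Small P P-isProp
  to-small {P = P} {P-isProp} = Equivalence.from (⌜⌝-spec P P-isProp)

  from-small : ∀ {a} {P : Set a} {P-isProp : isProp P} → Small P P-isProp → P
  from-small {P = P} {P-isProp} = Equivalence.to (⌜⌝-spec P P-isProp)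

  module _ {a r} {X : Set a} {R : X → X → Set r} where

    /-rec : ∀ {b} {Y : Set b} (f : X → Y) → (∀ {x y} → R x y → f x ≡ f y) → X / R → Y
    /-rec {Y = Y} f f-resp = /-elim (λ _ → Y) f λ r → trans (subst-const (/-eq r) _) (f-resp r)

    /-rec-β : ∀ {b} {Y : Set b} (f : X → Y) (f-resp : ∀ {x y} → R x y → f x ≡ f y) (x : X) →
              /-rec f f-resp [ x ] ≡ f x
    /-rec-β {Y = Y} f f-resp = /-elim-β (λ _ → Y) f _

    /-ind : ∀ {b} (P : X / R → Set b) → (∀ q → isProp (P q)) → (∀ x → P [ x ]) → ∀ q → P q
    /-ind P P-isProp f = /-elim P f λ _ → P-isProp _ _ _

    [_]-surjective : IsSurjective ax ([_] {R = R})
    [_]-surjective = /-ind _ (λ _ → ∥∥-isProp) λ x → ∣ x , refl ∣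

module Algebras {ℓ : Level} (ax : Axioms) (Σ' : Sig ℓ) where
  open Axioms ax
  open Sig Σ'
  open Alg

  Pos : (i : I) → A i → Set ℓ
  Pos i a = Σ[ k ∈ I ] B i a k

  _at_ : {X : I → Set ℓ} {i : I} {a : A i} → (B i a ⇀ X) → (y : Pos i a) → X (proj₁ y)
  g at (k , y) = g k y

  α-cong : (X : Alg Σ') {i : I} {a : A i} {g g′ : B i a ⇀ Carrier X} →
           (∀ y → g at y ≡ g′ at y) → α X i (a , g) ≡ α X i (a , g′)
  α-cong X g≗g′ = cong (λ g → α X _ (_ , g)) (funext λ k → funext λ y → g≗g′ (k , y))

  morphism-⋙ : (X Y : Alg Σ') (h : Carrier X ⇀ Carrier Y) → IsAlgMorphism Σ' X Y h →
               {V : I → Set ℓ} {i : I} (t : T Σ' V i) (ρ : V ⇀ Carrier X) →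
               h i (_⋙_ Σ' X t ρ) ≡ _⋙_ Σ' Y t (λ k v → h k (ρ k v))
  morphism-⋙ X Y h hom (η v) ρ = refl
  morphism-⋙ X Y h hom {i = i} (σ (a , b)) ρ = begin
    h i (α X i (a , λ k v → _⋙_ Σ' X (b k v) ρ))
      ≡⟨ sym (hom i a _) ⟩
    α Y i (a , λ k v → h k (_⋙_ Σ' X (b k v) ρ))
      ≡⟨ α-cong Y (λ (k , v) → morphism-⋙ X Y h hom (b k v) ρ) ⟩
    α Y i (a , λ k v → _⋙_ Σ' Y (b k v) (λ k v → h k (ρ k v)))
      ∎
    where open ≡-Reasoning

module WiscTrees {ℓ : Level} (ax : Axioms) (Σ' : Sig ℓ) (C : Set ℓ) (F : C → Set ℓ) where
  open Axioms ax
  open Ambient ax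
  open Sig Σ'
  open Alg
  open Algebras ax Σ'

  data Tree : I → Set ℓ where
    node : {i : I} (a : A i) (c : C) (p : F c → Pos i a) (ts : (z : F c) → Tree (proj₁ (p z))) → Tree i

  AllSurjective : {i : I} → Tree i → Set ℓ
  AllSurjective (node a c p ts) = IsSurjective ax p × ((z : F c) → AllSurjective (ts z))

  Denotes : (X : Alg Σ') {i : I} → Tree i → Carrier X i → Set ℓ
  Denotes X {i} (node a c p ts) x =
    Σ[ g ∈ (B i a ⇀ Carrier X) ] ((z : F c) → ∥ Denotes X (ts z) (g at p z) ∥) × (α X i (a , g) ≡ x)

  denotes-unique : (X : Alg Σ') {i : I} (t : Tree i) → AllSurjective t → AtMostOne (Denotes X t)
  denotes-unique X (node a c p ts) (p-surj , ts-surj) (g , g-den , refl) (g′ , g′-den , refl) =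
    α-cong X λ y → ∥∥-rec uip (λ (z , pz≡y) → subst (λ y → g at y ≡ g′ at y) pz≡y (agree z)) (p-surj y)
    where
    agree : (z : F c) → g at p z ≡ g′ at p z
    agree z = ∥∥-atMostOne (denotes-unique X (ts z) (ts-surj z)) (g-den z) (g′-den z)

  denotes-morphism : (X Y : Alg Σ') (h : Carrier X ⇀ Carrier Y) → IsAlgMorphism Σ' X Y h →
                     {i : I} (t : Tree i) {x : Carrier X i} → Denotes X t x → Denotes Y t (h i x)
  denotes-morphism X Y h hom (node a c p ts) (g , g-den , refl) =
    (λ k y → h k (g k y)) , (λ z → ∥∥-map (denotes-morphism X Y h hom (ts z)) (g-den z)) , hom _ a g

module Construction {ℓ : Level} (ax : Axioms) (Σ' : Sig ℓ) (ε : Eqs Σ') (C : Set ℓ) (F : C → Set ℓ)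
                    (wisc : IsWiscForFamily ax C F (Σ (Sig.I Σ') (Sig.A Σ'))
                                                   (λ (i , a) → Algebras.Pos ax Σ' i a)) where
  open Axioms ax
  open Ambient ax
  open Sig Σ'
  open Eqs ε
  open Alg
  open Algebras ax Σ'
  open WiscTrees ax Σ' C F

  IsModel : Alg Σ' → Set ℓ
  IsModel X = Satisfies Σ' X ε

  DenotesEverywhere : {i : I} → Tree i → Set (lsuc ℓ)
  DenotesEverywhere {i} t = (X : Alg Σ') → IsModel X → ∥ Σ[ x ∈ Carrier X i ] Denotes X t x ∥

  Good : {i : I} → Tree i → Set ℓ
  Good t = AllSurjective t × Small (DenotesEverywhere t) (Π-isProp λ _ → Π-isProp λ _ → ∥∥-isProp)

  GoodTree : I → Set ℓ
  GoodTree i = Σ (Tree i) Good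

  value-Σ : (X : Alg Σ') → IsModel X → {i : I} (u : GoodTree i) →
            Σ[ x ∈ Carrier X i ] ∥ Denotes X (proj₁ u) x ∥
  value-Σ X sat (t , t-surj , t-den) = unique-choice (denotes-unique X t t-surj) (from-small t-den X sat)

  value : (X : Alg Σ') → IsModel X → {i : I} → GoodTree i → Carrier X i
  value X sat u = proj₁ (value-Σ X sat u)

  value-denoted : (X : Alg Σ') (sat : IsModel X) {i : I} (u : GoodTree i) {x : Carrier X i} →
                  ∥ Denotes X (proj₁ u) x ∥ → value X sat u ≡ x
  value-denoted X sat u@(t , t-surj , _) = ∥∥-atMostOne (denotes-unique X t t-surj) (proj₂ (value-Σ X sat u))

  SameValues : {i : I} → GoodTree i → GoodTree i → Set (lsuc ℓ)
  SameValues u v = (X : Alg Σ') (sat : IsModel X) → value X sat u ≡ value X sat v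

  _≈_ : {i : I} → GoodTree i → GoodTree i → Set
  u ≈ v = Small (SameValues u v) (Π-isProp λ _ → Π-isProp λ _ → uip)

  QW : I → Set ℓ
  QW i = GoodTree i / _≈_

  interp : (X : Alg Σ') → IsModel X → QW ⇀ Carrier X
  interp X sat _ = /-rec (value X sat) (λ u≈v → from-small u≈v X sat)

  interp-β : (X : Alg Σ') (sat : IsModel X) {i : I} (u : GoodTree i) → interp X sat i [ u ] ≡ value X sat u
  interp-β X sat = /-rec-β (value X sat) _

  interp-denoted : (X : Alg Σ') (sat : IsModel X) {i : I} (u : GoodTree i) →
                   ∥ Denotes X (proj₁ u) (interp X sat i [ u ]) ∥
  interp-denoted X sat u =
    subst (λ x → ∥ Denotes X (proj₁ u) x ∥) (sym (interp-β X sat u)) (proj₂ (value-Σ X sat u))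

  SameInterpretations : {i : I} → QW i → QW i → Set (lsuc ℓ)
  SameInterpretations {i} q q′ = (X : Alg Σ') (sat : IsModel X) → interp X sat i q ≡ interp X sat i q′

  QW-ext : {i : I} {q q′ : QW i} → SameInterpretations q q′ → q ≡ q′
  QW-ext {q = q} {q′} = /-ind (λ q → ∀ q′ → SameInterpretations q q′ → q ≡ q′)
    (λ _ → Π-isProp λ _ → Π-isProp λ _ → uip)
    (λ u → /-ind (λ q′ → SameInterpretations [ u ] q′ → [ u ] ≡ q′) (λ _ → Π-isProp λ _ → uip)
      λ v same → /-eq (to-small λ X sat →
        trans (sym (interp-β X sat u)) (trans (same X sat) (interp-β X sat v))))
    q q′

  IsIntro : {i : I} {a : A i} → (B i a ⇀ QW) → QW i → Set (lsuc ℓ)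
  IsIntro {i} {a} b q =
    (X : Alg Σ') (sat : IsModel X) → interp X sat i q ≡ α X i (a , λ k y → interp X sat k (b k y))

  intro-unique : {i : I} {a : A i} (b : B i a ⇀ QW) → isProp (Σ (QW i) (IsIntro b))
  intro-unique b (q , q-intro) (q′ , q′-intro) = Σ-≡-isProp (λ _ → Π-isProp λ _ → Π-isProp λ _ → uip)
    (QW-ext λ X sat → trans (q-intro X sat) (sym (q′-intro X sat)))

  Representative : {i : I} {a : A i} → (B i a ⇀ QW) → Set ℓ
  Representative {i} {a} b = Σ[ y ∈ Pos i a ] Σ[ u ∈ GoodTree (proj₁ y) ] [ u ] ≡ b at y

  representative-surjective : {i : I} {a : A i} (b : B i a ⇀ QW) →
                              IsSurjective ax {X = Representative b} proj₁
  representative-surjective b y = ∥∥-map (λ (u , [u]≡by) → (y , u , [u]≡by) , refl) ([_]-surjective (b at y))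

  intro-from-cover : {i : I} {a : A i} (b : B i a ⇀ QW) (c : C) (f : F c → Representative b) →
                     IsSurjective ax (proj₁ ∘ f) → Σ (QW i) (IsIntro b)
  intro-from-cover {i} {a} b c f f-surj = [ t , t-good ] , λ X sat →
    trans (interp-β X sat (t , t-good)) (value-denoted X sat (t , t-good) ∣ denotes X sat ∣)
    where
    child : (z : F c) → GoodTree (proj₁ (proj₁ (f z)))
    child z = proj₁ (proj₂ (f z))

    t : Tree i
    t = node a c (proj₁ ∘ f) (proj₁ ∘ child)

    denotes : (X : Alg Σ') (sat : IsModel X) → Denotes X t (α X i (a , λ k y → interp X sat k (b k y)))
    denotes X sat = (λ k y → interp X sat k (b k y)) , child-denotes , refl
      where
      child-denotes : (z : F c) → ∥ Denotes X (proj₁ (child z)) (interp X sat _ (b at proj₁ (f z))) ∥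
      child-denotes z = subst (λ q → ∥ Denotes X (proj₁ (child z)) (interp X sat _ q) ∥)
                              (proj₂ (proj₂ (f z))) (interp-denoted X sat (child z))

    t-good : Good t
    t-good = (f-surj , λ z → proj₁ (proj₂ (child z))) , to-small λ X sat → ∣ _ , denotes X sat ∣

  intro : {i : I} {a : A i} (b : B i a ⇀ QW) → Σ (QW i) (IsIntro b)
  intro {i} {a} b = ∥∥-rec (intro-unique b) (λ (c , f , f-surj) → intro-from-cover b c f f-surj)
                           (wisc (i , a) (Representative b) proj₁ (representative-surjective b))

  qwintro : S Σ' QW ⇀ QW
  qwintro i (a , b) = proj₁ (intro b)

  QWA : Alg Σ'
  QWA = record { Carrier = QW ; α = qwintro }

  interp-morphism : (X : Alg Σ') (sat : IsModel X) → IsAlgMorphism Σ' QWA X (interp X sat)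
  interp-morphism X sat i a b = sym (proj₂ (intro b) X sat)

  qwsat : IsModel QWA
  qwsat i e ρ = QW-ext λ X sat →
    let interp-⋙ = morphism-⋙ QWA X (interp X sat) (interp-morphism X sat) in begin
      interp X sat i (_⋙_ Σ' QWA (l i e) ρ)              ≡⟨ interp-⋙ (l i e) ρ ⟩
      _⋙_ Σ' X (l i e) (λ k v → interp X sat k (ρ k v))  ≡⟨ sat i e _ ⟩
      _⋙_ Σ' X (r i e) (λ k v → interp X sat k (ρ k v))  ≡⟨ sym (interp-⋙ (r i e) ρ) ⟩
      interp X sat i (_⋙_ Σ' QWA (r i e) ρ)              ∎
    where open ≡-Reasoning

  -- Interpretations are morphisms, so they carry a denotation x of u in QWA to denotations
  -- in every model; hence x and [ u ] have the same interpretations.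
  denotes-own-class : {i : I} (u : GoodTree i) → ∥ Denotes QWA (proj₁ u) [ u ] ∥
  denotes-own-class u@(t , _ , t-den) =
    ∥∥-map (λ (x , x-den) → subst (Denotes QWA t) (sym (class≡ x x-den)) x-den) (from-small t-den QWA qwsat)
    where
    class≡ : (x : QW _) → Denotes QWA t x → [ u ] ≡ x
    class≡ x x-den = QW-ext λ X sat → trans (interp-β X sat u) (value-denoted X sat u
      ∣ denotes-morphism QWA X (interp X sat) (interp-morphism X sat) t x-den ∣)

  morphism-unique : (X : Alg Σ') (sat : IsModel X) (h : QW ⇀ Carrier X) → IsAlgMorphism Σ' QWA X h →
                    h ≡ interp X sat
  morphism-unique X sat h hom = funext λ i → funext (/-ind _ (λ _ → uip) λ u →
    sym (trans (interp-β X sat u)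
               (value-denoted X sat u (∥∥-map (denotes-morphism QWA X h hom (proj₁ u)) (denotes-own-class u)))))

  qwi : QWI Σ' ε
  qwi = record
    { QW = QW
    ; qwintro = qwintro
    ; qwsat = qwsat
    ; qwinit = λ X sat → interp X sat , interp-morphism X sat , morphism-unique X sat
    }

theorem6p1 : {ℓ : Level} (ax : Axioms) → IWISC ax ℓ →
    (Σ' : Sig ℓ) (ε : Eqs Σ') → Axioms.∥_∥ ax (QWI Σ' ε)
theorem6p1 ax iwisc Σ' ε =
  ∥∥-map (λ (C , F , wisc) → Construction.qwi ax Σ' ε C F wisc)
         (iwisc (Σ (Sig.I Σ') (Sig.A Σ')) (λ (i , a) → Algebras.Pos ax Σ' i a))
  where open Ambient ax
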